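{- Let $(\alpha_n)_{n\ge0}$ be a sequence of complex numbers. For integers $n\ge k\ge0$ define $$\Lambda_{n,k}=\sum_{\nu=0}^{k}\binom{n}{\nu}(2k-\nu)_k\,\alpha_{n-\nu},$$ where $(m)_k=m(m-1)\cdots(m-k+1)$ is the falling factorial. Then for $n-2\ge k\ge0$, $$n(n-1)\,\Lambda_{n-2,k}=\Lambda_{n,k+2}-(4k+6)\Lambda_{n,k+1}.$$ -}

module Defs where

open import Level using (Level)
import Data.Nat as ℕ
open ℕ using (ℕ; zero; suc; _∸_)
open import Data.Nat.Combinatorics using (_C_)
open import Algebra.Bundles using (CommutativeRing)

falling : ℕ → ℕ → ℕ
falling m zero    = 1
falling m (suc k) = m ℕ.* falling (m ∸ 1) k

module _ {c ℓ : Level} (R : CommutativeRing c ℓ) where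
  open CommutativeRing R

  fromℕ : ℕ → Carrier
  fromℕ zero    = 0#
  fromℕ (suc n) = 1# + fromℕ n

  sumTo : ℕ → (ℕ → Carrier) → Carrier
  sumTo zero    f = f 0
  sumTo (suc k) f = sumTo k f + f (suc k)

  Λ : (ℕ → Carrier) → ℕ → ℕ → Carrier
  Λ α n k = sumTo k (λ ν → fromℕ ((n C ν) ℕ.* falling ((2 ℕ.* k) ∸ ν) k) * α (n ∸ ν))

{-# OPTIONS --safe #-}
module Submission where

-- Write ν + e = k + 2 and a = 2(k + 1) − ν = k + e. Since (a)_{k+1} = e (a)_k and
-- (a + 2)(a + 1) = (4k + 6) e + ν(ν − 1), the coefficient (2k + 4 − ν)_{k+2} = (a + 2)(a + 1)(a)_k
-- splits as (4k + 6)(a)_{k+1} + ν(ν − 1)(a)_k. Summed against C(n, ν) α_{n−ν}, the first part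
-- is (4k + 6) Λ_{n,k+1}, its extra term ν = k + 2 vanishing as (k)_{k+1} = 0; in the second the
-- terms ν = 0, 1 vanish and absorption, ν(ν − 1) C(n, ν) = n(n − 1) C(n − 2, ν − 2), turns it
-- into n(n − 1) Λ_{n−2,k}.

open import Defs
open import Level using (Level)
open import Data.Nat using (ℕ; zero; suc; _+_; _*_; _∸_; _≤_; _<_; z≤n; s≤s)
import Data.Nat.Properties as ℕ
open import Data.Nat.Combinatorics using (_C_; nC1≡n; nCk+nC[k+1]≡[n+1]C[k+1])
open import Data.Nat.Tactic.RingSolver using (solve; solve-∀)
open import Data.List using (_∷_; [])
open import Data.Product using (_,_)
open import Algebra.Bundles using (CommutativeRing)
open import Relation.Binary.PropositionalEquality
  using (_≡_; refl; sym; trans; cong; cong₂; module ≡-Reasoning)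

[1+k]*[1+n]C[1+k]≡[1+n]*nCk : ∀ n k → suc k * (suc n C suc k) ≡ suc n * (n C k)
[1+k]*[1+n]C[1+k]≡[1+n]*nCk zero    zero    = refl
[1+k]*[1+n]C[1+k]≡[1+n]*nCk zero    (suc k) = ℕ.*-zeroʳ (2 + k)
[1+k]*[1+n]C[1+k]≡[1+n]*nCk (suc n) zero    =
  trans (ℕ.+-identityʳ _) (trans (nC1≡n (2 + n)) (sym (ℕ.*-identityʳ (2 + n))))
[1+k]*[1+n]C[1+k]≡[1+n]*nCk (suc n) (suc k) = begin
  (2 + k) * ((2 + n) C (2 + k)) ≡⟨ cong ((2 + k) *_) (nCk+nC[k+1]≡[n+1]C[k+1] (suc n) (suc k)) ⟨
  (2 + k) * (a + b)              ≡⟨ distribute k a b ⟩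
  (1 + k) * a + a + (2 + k) * b  ≡⟨ cong₂ (λ u v → u + a + v) ([1+k]*[1+n]C[1+k]≡[1+n]*nCk n k)
                                                              ([1+k]*[1+n]C[1+k]≡[1+n]*nCk n (suc k)) ⟩
  (1 + n) * c + a + (1 + n) * d  ≡⟨ collect n a c d ⟩
  (1 + n) * (c + d) + a          ≡⟨ cong (λ u → (1 + n) * u + a) (nCk+nC[k+1]≡[n+1]C[k+1] n k) ⟩
  (1 + n) * a + a                ≡⟨ ℕ.+-comm ((1 + n) * a) a ⟩
  (2 + n) * a                    ∎
  where
  open ≡-Reasoning
  a = suc n C suc k
  b = suc n C suc (suc k)
  c = n C k
  d = n C suc k
  distribute : ∀ k a b → (2 + k) * (a + b) ≡ (1 + k) * a + a + (2 + k) * b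
  distribute = solve-∀
  collect : ∀ n a c d → (1 + n) * c + a + (1 + n) * d ≡ (1 + n) * (c + d) + a
  collect = solve-∀

[1+k]*nC[1+k]≡n*[n∸1]Ck : ∀ n k → suc k * (n C suc k) ≡ n * ((n ∸ 1) C k)
[1+k]*nC[1+k]≡n*[n∸1]Ck zero    k = ℕ.*-zeroʳ (suc k)
[1+k]*nC[1+k]≡n*[n∸1]Ck (suc n) k = [1+k]*[1+n]C[1+k]≡[1+n]*nCk n k

[2+k]*[1+k]*nC[2+k]≡n*[n∸1]*[n∸2]Ck : ∀ n k →
  (2 + k) * (1 + k) * (n C (2 + k)) ≡ n * (n ∸ 1) * ((n ∸ 2) C k)
[2+k]*[1+k]*nC[2+k]≡n*[n∸1]*[n∸2]Ck n k = begin
  (2 + k) * (1 + k) * (n C (2 + k))        ≡⟨ swap (2 + k) (1 + k) (n C (2 + k)) ⟩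
  (1 + k) * ((2 + k) * (n C (2 + k)))      ≡⟨ cong ((1 + k) *_) ([1+k]*nC[1+k]≡n*[n∸1]Ck n (suc k)) ⟩
  (1 + k) * (n * ((n ∸ 1) C (1 + k)))      ≡⟨ swap′ (1 + k) n ((n ∸ 1) C (1 + k)) ⟩
  n * ((1 + k) * ((n ∸ 1) C (1 + k)))      ≡⟨ cong (n *_) ([1+k]*nC[1+k]≡n*[n∸1]Ck (n ∸ 1) k) ⟩
  n * ((n ∸ 1) * ((n ∸ 1 ∸ 1) C k))        ≡⟨ cong (λ m → n * ((n ∸ 1) * (m C k))) (ℕ.∸-+-assoc n 1 1) ⟩
  n * ((n ∸ 1) * ((n ∸ 2) C k))            ≡⟨ ℕ.*-assoc n (n ∸ 1) _ ⟨
  n * (n ∸ 1) * ((n ∸ 2) C k)              ∎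
  where
  open ≡-Reasoning
  swap : ∀ a b c → a * b * c ≡ b * (a * c)
  swap = solve-∀
  swap′ : ∀ a b c → a * (b * c) ≡ b * (a * c)
  swap′ = solve-∀

falling-suc : ∀ a k → falling a (suc k) ≡ falling a k * (a ∸ k)
falling-suc a       zero    = ℕ.*-comm a 1
falling-suc zero    (suc k) = refl
falling-suc (suc a) (suc k) = begin
  suc a * (a * falling (a ∸ 1) k)   ≡⟨ cong (suc a *_) (falling-suc a k) ⟩
  suc a * (falling a k * (a ∸ k))   ≡⟨ ℕ.*-assoc (suc a) (falling a k) (a ∸ k) ⟨
  suc a * falling a k * (a ∸ k)     ∎
  where open ≡-Reasoning

falling-< : ∀ {a k} → a < k → falling a k ≡ 0
falling-< {zero}  {suc k} _         = refl
falling-< {suc a} {suc k} (s≤s a<k) = trans (cong (suc a *_) (falling-< a<k)) (ℕ.*-zeroʳ (suc a))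

quadratic-split : ∀ ν e k → ν + e ≡ 2 + k → (2 + (k + e)) * (1 + (k + e)) ≡ (4 * k + 6) * e + ν * (ν ∸ 1)
quadratic-split 0             .(2 + k) k        refl = solve (k ∷ [])
quadratic-split 1             .(1 + k) k        refl = solve (k ∷ [])
quadratic-split (suc (suc μ)) e        .(μ + e) refl = expand μ e
  where
  expand : ∀ μ e → (2 + (μ + e + e)) * (1 + (μ + e + e)) ≡ (4 * (μ + e) + 6) * e + (2 + μ) * (1 + μ)
  expand = solve-∀

module _ (ν e k : ℕ) (ν+e≡2+k : ν + e ≡ 2 + k) where
  open ≡-Reasoning

  2[1+k]∸ν≡k+e : 2 * (1 + k) ∸ ν ≡ k + e
  2[1+k]∸ν≡k+e = trans (cong (_∸ ν) (begin
    2 * (1 + k)  ≡⟨ solve (k ∷ []) ⟩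
    k + (2 + k)  ≡⟨ cong (k +_) ν+e≡2+k ⟨
    k + (ν + e)  ≡⟨ solve (k ∷ ν ∷ e ∷ []) ⟩
    ν + (k + e)  ∎)) (ℕ.m+n∸m≡n ν (k + e))

  2[2+k]∸ν≡2+[k+e] : 2 * (2 + k) ∸ ν ≡ 2 + (k + e)
  2[2+k]∸ν≡2+[k+e] = trans (cong (_∸ ν) (begin
    2 * (2 + k)        ≡⟨ solve (k ∷ []) ⟩
    2 + (k + (2 + k))  ≡⟨ cong (λ m → 2 + (k + m)) ν+e≡2+k ⟨
    2 + (k + (ν + e))  ≡⟨ solve (k ∷ ν ∷ e ∷ []) ⟩
    ν + (2 + (k + e))  ∎)) (ℕ.m+n∸m≡n ν (2 + (k + e)))

  falling-split : falling (2 * (2 + k) ∸ ν) (2 + k) ≡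
                  (4 * k + 6) * falling (2 * (1 + k) ∸ ν) (1 + k) + ν * (ν ∸ 1) * falling (2 * (1 + k) ∸ ν) k
  falling-split = begin
    falling (2 * (2 + k) ∸ ν) (2 + k)  ≡⟨ cong (λ b → falling b (2 + k)) 2[2+k]∸ν≡2+[k+e] ⟩
    (2 + a) * ((1 + a) * F)            ≡⟨ ℕ.*-assoc (2 + a) (1 + a) F ⟨
    (2 + a) * (1 + a) * F              ≡⟨ cong (_* F) (quadratic-split ν e k ν+e≡2+k) ⟩
    ((4 * k + 6) * e + w) * F          ≡⟨ distribute (4 * k + 6) e w F ⟩
    (4 * k + 6) * (F * e) + w * F      ≡⟨ cong (λ x → (4 * k + 6) * x + w * F) falling-a[1+k] ⟨
    (4 * k + 6) * falling a (1 + k) + w * F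
      ≡⟨ cong (λ b → (4 * k + 6) * falling b (1 + k) + w * falling b k) 2[1+k]∸ν≡k+e ⟨
    (4 * k + 6) * falling (2 * (1 + k) ∸ ν) (1 + k) + w * falling (2 * (1 + k) ∸ ν) k  ∎
    where
    a = k + e
    F = falling a k
    w = ν * (ν ∸ 1)
    falling-a[1+k] : falling a (1 + k) ≡ F * e
    falling-a[1+k] = trans (falling-suc a k) (cong (F *_) (ℕ.m+n∸m≡n k e))
    distribute : ∀ m e w F → (m * e + w) * F ≡ m * (F * e) + w * F
    distribute = solve-∀

falling[2[1+k]∸[2+k]][1+k]≡0 : ∀ k → falling (2 * (1 + k) ∸ (2 + k)) (1 + k) ≡ 0
falling[2[1+k]∸[2+k]][1+k]≡0 k =
  trans (cong (λ a → falling a (1 + k)) (2[1+k]∸ν≡k+e (2 + k) 0 k (ℕ.+-identityʳ (2 + k))))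
        (falling-< (s≤s (ℕ.≤-reflexive (ℕ.+-identityʳ k))))

2[1+k]∸[2+μ]≡2k∸μ : ∀ k μ → 2 * (1 + k) ∸ (2 + μ) ≡ 2 * k ∸ μ
2[1+k]∸[2+μ]≡2k∸μ k μ = cong (_∸ suc μ) (ℕ.+-suc k (k + 0))

module _ {r ℓ : Level} (R : CommutativeRing r ℓ) where
  open CommutativeRing R
    renaming (_+_ to _+ᴿ_; _*_ to _*ᴿ_; refl to ≈-refl; sym to ≈-sym; trans to ≈-trans)
  open import Algebra.Properties.Semiring.Mult semiring using (_×_; ×-homo-+; ×1-homo-*)
  open import Algebra.Properties.CommutativeSemigroup +-commutativeSemigroup using (interchange)
  open import Relation.Binary.Reasoning.Setoid setoid

  fromℕ≡×1# : ∀ n → fromℕ R n ≡ n × 1#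
  fromℕ≡×1# zero    = refl
  fromℕ≡×1# (suc n) = cong (1# +ᴿ_) (fromℕ≡×1# n)

  fromℕ-+ : ∀ m n → fromℕ R (m + n) ≈ fromℕ R m +ᴿ fromℕ R n
  fromℕ-+ m n rewrite fromℕ≡×1# (m + n) | fromℕ≡×1# m | fromℕ≡×1# n = ×-homo-+ 1# m n

  fromℕ-* : ∀ m n → fromℕ R (m * n) ≈ fromℕ R m *ᴿ fromℕ R n
  fromℕ-* m n rewrite fromℕ≡×1# (m * n) | fromℕ≡×1# m | fromℕ≡×1# n = ×1-homo-* m n

  fromℕ-*-assoc : ∀ m n x → fromℕ R (m * n) *ᴿ x ≈ fromℕ R m *ᴿ (fromℕ R n *ᴿ x)
  fromℕ-*-assoc m n x = ≈-trans (*-congʳ (fromℕ-* m n)) (*-assoc _ _ _)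

  fromℕ-*-+ : ∀ m n o x → fromℕ R (m * n + o) *ᴿ x ≈ fromℕ R m *ᴿ (fromℕ R n *ᴿ x) +ᴿ fromℕ R o *ᴿ x
  fromℕ-*-+ m n o x = begin
    fromℕ R (m * n + o) *ᴿ x                        ≈⟨ *-congʳ (fromℕ-+ (m * n) o) ⟩
    (fromℕ R (m * n) +ᴿ fromℕ R o) *ᴿ x             ≈⟨ distribʳ x _ _ ⟩
    fromℕ R (m * n) *ᴿ x +ᴿ fromℕ R o *ᴿ x          ≈⟨ +-congʳ (fromℕ-*-assoc m n x) ⟩
    fromℕ R m *ᴿ (fromℕ R n *ᴿ x) +ᴿ fromℕ R o *ᴿ x ∎

  sumTo-cong : ∀ k {f g} → (∀ {i} → i ≤ k → f i ≈ g i) → sumTo R k f ≈ sumTo R k g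
  sumTo-cong zero    f≈g = f≈g z≤n
  sumTo-cong (suc k) f≈g = +-cong (sumTo-cong k (λ i≤k → f≈g (ℕ.m≤n⇒m≤1+n i≤k))) (f≈g ℕ.≤-refl)

  sumTo-+ : ∀ k f g → sumTo R k (λ i → f i +ᴿ g i) ≈ sumTo R k f +ᴿ sumTo R k g
  sumTo-+ zero    f g = ≈-refl
  sumTo-+ (suc k) f g = ≈-trans (+-congʳ (sumTo-+ k f g)) (interchange _ _ _ _)

  sumTo-*ˡ : ∀ k x f → sumTo R k (λ i → x *ᴿ f i) ≈ x *ᴿ sumTo R k f
  sumTo-*ˡ zero    x f = ≈-refl
  sumTo-*ˡ (suc k) x f = ≈-trans (+-congʳ (sumTo-*ˡ k x f)) (≈-sym (distribˡ x _ _))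

  sumTo-suc : ∀ k f → sumTo R (suc k) f ≈ f 0 +ᴿ sumTo R k (λ i → f (suc i))
  sumTo-suc zero    f = ≈-refl
  sumTo-suc (suc k) f = ≈-trans (+-congʳ (sumTo-suc k f)) (+-assoc _ _ _)

  Λ-recurrence : ∀ (α : ℕ → Carrier) n k →
    Λ R α n (2 + k) ≈ fromℕ R (4 * k + 6) *ᴿ Λ R α n (1 + k) +ᴿ fromℕ R (n * (n ∸ 1)) *ᴿ Λ R α (n ∸ 2) k
  Λ-recurrence α n k = begin
    sumTo R (2 + k) (weighted a)                           ≈⟨ sumTo-cong (2 + k) split ⟩
    sumTo R (2 + k) (λ ν → c *ᴿ weighted b ν +ᴿ weighted d ν)
      ≈⟨ sumTo-+ (2 + k) (λ ν → c *ᴿ weighted b ν) (weighted d) ⟩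
    sumTo R (2 + k) (λ ν → c *ᴿ weighted b ν) +ᴿ sumTo R (2 + k) (weighted d)
      ≈⟨ +-cong (sumTo-*ˡ (2 + k) c (weighted b)) d-sum ⟩
    c *ᴿ sumTo R (2 + k) (weighted b) +ᴿ X *ᴿ Λ R α (n ∸ 2) k  ≈⟨ +-congʳ (*-congˡ b-sum) ⟩
    c *ᴿ Λ R α n (1 + k) +ᴿ X *ᴿ Λ R α (n ∸ 2) k               ∎
    where
    c X : Carrier
    c = fromℕ R (4 * k + 6)
    X = fromℕ R (n * (n ∸ 1))

    a b d : ℕ → ℕ
    a ν = (n C ν) * falling (2 * (2 + k) ∸ ν) (2 + k)
    b ν = (n C ν) * falling (2 * (1 + k) ∸ ν) (1 + k)
    d ν = ν * (ν ∸ 1) * (n C ν) * falling (2 * (1 + k) ∸ ν) k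

    weighted : (ℕ → ℕ) → ℕ → Carrier
    weighted w ν = fromℕ R (w ν) *ᴿ α (n ∸ ν)

    split : ∀ {ν} → ν ≤ 2 + k → weighted a ν ≈ c *ᴿ weighted b ν +ᴿ weighted d ν
    split {ν} ν≤2+k with ℕ.m≤n⇒∃[o]m+o≡n ν≤2+k
    ... | e , ν+e≡2+k =
      ≈-trans (*-congʳ (reflexive (cong (fromℕ R) a≡cb+d))) (fromℕ-*-+ (4 * k + 6) (b ν) (d ν) _)
      where
      distribute : ∀ x m y w z → x * (m * y + w * z) ≡ m * (x * y) + w * x * z
      distribute = solve-∀
      a≡cb+d : a ν ≡ (4 * k + 6) * b ν + d ν
      a≡cb+d = trans (cong ((n C ν) *_) (falling-split ν e k ν+e≡2+k))
                     (distribute (n C ν) (4 * k + 6) (falling (2 * (1 + k) ∸ ν) (1 + k))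
                                 (ν * (ν ∸ 1)) (falling (2 * (1 + k) ∸ ν) k))

    b-sum : sumTo R (2 + k) (weighted b) ≈ Λ R α n (1 + k)
    b-sum = begin
      Λ R α n (1 + k) +ᴿ weighted b (2 + k)
        ≈⟨ +-congˡ (≈-trans (*-congʳ (reflexive (cong (fromℕ R) b[2+k]≡0))) (zeroˡ _)) ⟩
      Λ R α n (1 + k) +ᴿ 0#                  ≈⟨ +-identityʳ _ ⟩
      Λ R α n (1 + k)                        ∎
      where
      b[2+k]≡0 : b (2 + k) ≡ 0
      b[2+k]≡0 = trans (cong ((n C (2 + k)) *_) (falling[2[1+k]∸[2+k]][1+k]≡0 k)) (ℕ.*-zeroʳ (n C (2 + k)))

    d-sum : sumTo R (2 + k) (weighted d) ≈ X *ᴿ Λ R α (n ∸ 2) k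
    d-sum = begin
      sumTo R (2 + k) (weighted d)                                     ≈⟨ sumTo-suc (1 + k) _ ⟩
      weighted d 0 +ᴿ sumTo R (1 + k) (λ ν → weighted d (1 + ν))       ≈⟨ +-congˡ (sumTo-suc k _) ⟩
      weighted d 0 +ᴿ (weighted d 1 +ᴿ sumTo R k (λ μ → weighted d (2 + μ)))
        -- ν (ν ∸ 1) computes to 0 for ν = 0, 1, so these two terms are literally 0# *ᴿ _
        ≈⟨ +-cong (zeroˡ _) (+-cong (zeroˡ _) (sumTo-cong k shift)) ⟩
      0# +ᴿ (0# +ᴿ sumTo R k (λ μ → X *ᴿ T μ))                         ≈⟨ ≈-trans (+-identityˡ _) (+-identityˡ _) ⟩
      sumTo R k (λ μ → X *ᴿ T μ)                                       ≈⟨ sumTo-*ˡ k X T ⟩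
      X *ᴿ Λ R α (n ∸ 2) k                                             ∎
      where
      T : ℕ → Carrier
      T μ = fromℕ R (((n ∸ 2) C μ) * falling (2 * k ∸ μ) k) *ᴿ α (n ∸ 2 ∸ μ)
      shift : ∀ {μ} → μ ≤ k → weighted d (2 + μ) ≈ X *ᴿ T μ
      shift {μ} _ =
        ≈-trans (*-cong (reflexive (cong (fromℕ R) d[2+μ]≡)) (reflexive (cong α (sym (ℕ.∸-+-assoc n 2 μ)))))
                (fromℕ-*-assoc (n * (n ∸ 1)) _ _)
        where
        d[2+μ]≡ : d (2 + μ) ≡ n * (n ∸ 1) * (((n ∸ 2) C μ) * falling (2 * k ∸ μ) k)
        d[2+μ]≡ = trans (cong₂ _*_ ([2+k]*[1+k]*nC[2+k]≡n*[n∸1]*[n∸2]Ck n μ)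
                                   (cong (λ x → falling x k) (2[1+k]∸[2+μ]≡2k∸μ k μ)))
                        (ℕ.*-assoc (n * (n ∸ 1)) ((n ∸ 2) C μ) (falling (2 * k ∸ μ) k))

lemma5p1 : ∀ {c ℓ : Level} (R : CommutativeRing c ℓ) (α : ℕ → CommutativeRing.Carrier R) (n k : ℕ) →
    k + 2 ≤ n →
    CommutativeRing._≈_ R
      (CommutativeRing._*_ R (fromℕ R (n * (n ∸ 1))) (Λ R α (n ∸ 2) k))
      (CommutativeRing._-_ R (Λ R α n (k + 2)) (CommutativeRing._*_ R (fromℕ R (4 * k + 6)) (Λ R α n (k + 1))))
-- The recurrence holds for every n.
lemma5p1 R α n k _ rewrite ℕ.+-comm k 2 | ℕ.+-comm k 1 =
  x≈z//y _ _ _ (≈-trans (+-comm _ _) (≈-sym (Λ-recurrence R α n k)))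
  where
  open CommutativeRing R using (+-comm; +-group) renaming (sym to ≈-sym; trans to ≈-trans)
  open import Algebra.Properties.Group +-group using (x≈z//y)
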